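{- Let $(a_n)_{n\ge0}$ be defined by $a_0=0$, $a_1=1$, $a_2=2$ and $a_n=a_{n-1}+a_{n-3}$ for $n\ge 3$. Let $x_1,x_2,x_3$ be the roots of $x^3+x-1$ and for integers $n$ put $p_n=(x_1x_2)^n+(x_2x_3)^n+(x_3x_1)^n$. Then for every $n\ge 0$, $$a_n=\frac{1}{31}\bigl(6p_{n+1}+4p_n+7p_{n-1}+9p_{n-2}\bigr).$$ -}

module Defs where

open import Level using (Level)
open import Data.Nat as ℕ using (ℕ; zero; suc)
open import Data.Integer as ℤ using (ℤ; +_; -[1+_])
open import Algebra.Bundles using (CommutativeRing)

a : ℕ → ℕ
a 0 = 0
a 1 = 1
a 2 = 2
a (suc (suc (suc n))) = a (suc (suc n)) ℕ.+ a n

module RingDefs {c ℓ : Level} (R : CommutativeRing c ℓ) where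
  open CommutativeRing R

  pow : Carrier → ℕ → Carrier
  pow x zero = 1#
  pow x (suc n) = x * pow x n

  natC : ℕ → Carrier
  natC zero = 0#
  natC (suc n) = 1# + natC n

  -- integer power of a unit u with (given) inverse v:
  -- u^n for n ≥ 0 and v^k = u^(-k) for n = -k < 0
  zpow : Carrier → Carrier → ℤ → Carrier
  zpow u v (+ n) = pow u n
  zpow u v -[1+ k ] = pow v (suc k)

  -- "x₁,x₂,x₃ are the roots of x³ + x - 1": (X - x₁)(X - x₂)(X - x₃) = X³ + X - 1
  -- as polynomials, i.e. equality of the coefficients of X², X¹, X⁰.
  IsRootTriple : Carrier → Carrier → Carrier → Set ℓ
  IsRootTriple x₁ x₂ x₃ =
    (- (x₁ + x₂ + x₃) ≈ 0#) ×'
    ((x₁ * x₂ + x₂ * x₃ + x₃ * x₁ ≈ 1#) ×'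
     (- (x₁ * x₂ * x₃) ≈ - 1#))
    where
      open import Data.Product using () renaming (_×_ to _×'_)

  -- p_n = (x₁x₂)^n + (x₂x₃)^n + (x₃x₁)^n for integer n, where w₁₂, w₂₃, w₃₁
  -- are inverses of x₁x₂, x₂x₃, x₃x₁ respectively (used for negative n)
  p : (x₁ x₂ x₃ w₁₂ w₂₃ w₃₁ : Carrier) → ℤ → Carrier
  p x₁ x₂ x₃ w₁₂ w₂₃ w₃₁ n =
    zpow (x₁ * x₂) w₁₂ n + zpow (x₂ * x₃) w₂₃ n + zpow (x₃ * x₁) w₃₁ n

-- Call a sequence u : ℕ → R a
-- Narayana sequence if u (k+3) = u (k+2) + u k for all k. Both sides of the
-- identity 31 aₙ = 6 p_{n+1} + 4 pₙ + 7 p_{n-1} + 9 p_{n-2} are Narayana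
-- sequences in n, so it suffices to compare them at three consecutive
-- indices; since the recurrence can be run backwards in a ring, the indices
-- n = 1, 2, 3 will do, which keeps all the values involved non-negative.
--
--   * aₙ is Narayana by definition, and Narayana sequences are closed under
--     shifts, scalar multiples and sums, hence under the fixed combination
--     u ↦ 6 u(k+3) + 4 u(k+2) + 7 u(k+1) + 9 u(k).
--   * If x₁, x₂, x₃ are the roots of X³ + X - 1, every product y = xᵢxⱼ is a
--     root of X³ - X² - 1 (Vieta), and its inverse is the remaining root.
--     Hence k ↦ y^(k-2) is Narayana, and so is k ↦ p_{k-2}.
--   * The values p₋₁ = 0, p₀ = 3, p₁ = 1 follow from Vieta's formulas, and
--     p₂, p₃, p₄ from the recurrence; comparing at n = 1, 2, 3 is then
--     arithmetic in ℕ transported along n ↦ n·1.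
module Submission where

open import Defs
open import Level using (Level)
open import Data.Nat using (ℕ; zero; suc)
open import Data.Integer using (ℤ; +_) renaming (_+_ to _+ℤ_; _-_ to _-ℤ_)
open import Algebra.Bundles using (CommutativeRing)

import Data.Nat as ℕ
import Data.Nat.Properties as ℕₚ
open import Data.Integer.Properties using ([1+m]⊖[1+n]≡m⊖n)
open import Data.Product using (_,_)
open import Relation.Binary.PropositionalEquality using (_≡_; cong; cong₂)
import Algebra.Properties.Ring as RingProperties
import Algebra.Properties.CommutativeSemigroup as CommutativeSemigroupProperties
import Algebra.Solver.Ring.NaturalCoefficients.Default as NaturalSolver
import Relation.Binary.Reasoning.Setoid as SetoidReasoning

module NarayanaIdentity {c ℓ : Level} (R : CommutativeRing c ℓ) where
  open CommutativeRing R
  open RingDefs R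
  open RingProperties ring using (-‿injective; -0#≈0#; +-cancelˡ)
  open CommutativeSemigroupProperties +-commutativeSemigroup using (interchange)
  open NaturalSolver commutativeSemiring using (solve; _:=_; _:+_; _:*_)
  open SetoidReasoning setoid

  natC-homo-+ : ∀ m n → natC (m ℕ.+ n) ≈ natC m + natC n
  natC-homo-+ zero    n = sym (+-identityˡ (natC n))
  natC-homo-+ (suc m) n = trans (+-congˡ (natC-homo-+ m n)) (sym (+-assoc 1# (natC m) (natC n)))

  natC-homo-* : ∀ m n → natC (m ℕ.* n) ≈ natC m * natC n
  natC-homo-* zero    n = sym (zeroˡ (natC n))
  natC-homo-* (suc m) n = begin
    natC (n ℕ.+ m ℕ.* n)           ≈⟨ natC-homo-+ n (m ℕ.* n) ⟩
    natC n + natC (m ℕ.* n)        ≈⟨ +-cong (sym (*-identityˡ (natC n))) (natC-homo-* m n) ⟩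
    1# * natC n + natC m * natC n  ≈⟨ distribʳ (natC n) 1# (natC m) ⟨
    (1# + natC m) * natC n         ∎

  IsNarayana : (ℕ → Carrier) → Set ℓ
  IsNarayana u = ∀ k → u (3 ℕ.+ k) ≈ u (2 ℕ.+ k) + u k

  -- The recurrence determines a sequence from any three consecutive values;
  -- the value at 0 is recovered by cancelling u 2 in u 3 = u 2 + u 0.
  narayana-unique : ∀ {u v} → IsNarayana u → IsNarayana v →
                    u 1 ≈ v 1 → u 2 ≈ v 2 → u 3 ≈ v 3 → ∀ k → u k ≈ v k
  narayana-unique {u} {v} hu hv e₁ e₂ e₃ = agree
    where
    agree : ∀ k → u k ≈ v k
    agree 0 = +-cancelˡ (u 2) (u 0) (v 0) (begin
      u 2 + u 0 ≈⟨ hu 0 ⟨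
      u 3       ≈⟨ e₃ ⟩
      v 3       ≈⟨ hv 0 ⟩
      v 2 + v 0 ≈⟨ +-congʳ e₂ ⟨
      u 2 + v 0 ∎)
    agree 1 = e₁
    agree 2 = e₂
    agree 3 = e₃
    agree (suc (suc (suc (suc k)))) = begin
      u (4 ℕ.+ k)               ≈⟨ hu (suc k) ⟩
      u (3 ℕ.+ k) + u (suc k)   ≈⟨ +-cong (agree (suc (suc (suc k)))) (agree (suc k)) ⟩
      v (3 ℕ.+ k) + v (suc k)   ≈⟨ hv (suc k) ⟨
      v (4 ℕ.+ k)               ∎

  narayana-shift : ∀ {u} → IsNarayana u → IsNarayana (λ k → u (suc k))
  narayana-shift hu k = hu (suc k)

  narayana-scale : ∀ {u} (s : Carrier) → IsNarayana u → IsNarayana (λ k → s * u k)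
  narayana-scale s hu k = trans (*-congˡ (hu k)) (distribˡ s _ _)

  narayana-sum : ∀ {u v} → IsNarayana u → IsNarayana v → IsNarayana (λ k → u k + v k)
  narayana-sum hu hv k = trans (+-cong (hu k) (hv k)) (interchange _ _ _ _)

  weighted : (c₃ c₂ c₁ c₀ : Carrier) → (ℕ → Carrier) → ℕ → Carrier
  weighted c₃ c₂ c₁ c₀ u k =
    c₃ * u (3 ℕ.+ k) + c₂ * u (2 ℕ.+ k) + c₁ * u (suc k) + c₀ * u k

  narayana-weighted : ∀ {u} c₃ c₂ c₁ c₀ → IsNarayana u →
                      IsNarayana (weighted c₃ c₂ c₁ c₀ u)
  narayana-weighted c₃ c₂ c₁ c₀ hu =
    narayana-sum (narayana-sum (narayana-sum
      (narayana-scale c₃ (narayana-shift (narayana-shift (narayana-shift hu))))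
      (narayana-scale c₂ (narayana-shift (narayana-shift hu))))
      (narayana-scale c₁ (narayana-shift hu)))
      (narayana-scale c₀ hu)

  narayana-a : IsNarayana (λ k → natC (a k))
  narayana-a k = natC-homo-+ (a (2 ℕ.+ k)) (a k)

  narayana-natC : ∀ {u} → IsNarayana u → ∀ k l n →
                  u k ≈ natC l → u (2 ℕ.+ k) ≈ natC n → u (3 ℕ.+ k) ≈ natC (n ℕ.+ l)
  narayana-natC hu k l n eₖ eₖ₊₂ =
    trans (hu k) (trans (+-cong eₖ₊₂ eₖ) (sym (natC-homo-+ n l)))

  weighted-natC : ∀ {u} c₃ c₂ c₁ c₀ k n₃ n₂ n₁ n₀ →
    u (3 ℕ.+ k) ≈ natC n₃ → u (2 ℕ.+ k) ≈ natC n₂ → u (suc k) ≈ natC n₁ → u k ≈ natC n₀ →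
    weighted (natC c₃) (natC c₂) (natC c₁) (natC c₀) u k
      ≈ natC (c₃ ℕ.* n₃ ℕ.+ c₂ ℕ.* n₂ ℕ.+ c₁ ℕ.* n₁ ℕ.+ c₀ ℕ.* n₀)
  weighted-natC c₃ c₂ c₁ c₀ k n₃ n₂ n₁ n₀ e₃ e₂ e₁ e₀ = begin
    natC c₃ * _ + natC c₂ * _ + natC c₁ * _ + natC c₀ * _
      ≈⟨ +-cong (+-cong (+-cong (term c₃ e₃) (term c₂ e₂)) (term c₁ e₁)) (term c₀ e₀) ⟩
    natC (c₃ ℕ.* n₃) + natC (c₂ ℕ.* n₂) + natC (c₁ ℕ.* n₁) + natC (c₀ ℕ.* n₀)
      ≈⟨ +-congʳ (+-congʳ (natC-homo-+ (c₃ ℕ.* n₃) (c₂ ℕ.* n₂))) ⟨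
    natC (c₃ ℕ.* n₃ ℕ.+ c₂ ℕ.* n₂) + natC (c₁ ℕ.* n₁) + natC (c₀ ℕ.* n₀)
      ≈⟨ +-congʳ (natC-homo-+ (c₃ ℕ.* n₃ ℕ.+ c₂ ℕ.* n₂) (c₁ ℕ.* n₁)) ⟨
    natC (c₃ ℕ.* n₃ ℕ.+ c₂ ℕ.* n₂ ℕ.+ c₁ ℕ.* n₁) + natC (c₀ ℕ.* n₀)
      ≈⟨ natC-homo-+ (c₃ ℕ.* n₃ ℕ.+ c₂ ℕ.* n₂ ℕ.+ c₁ ℕ.* n₁) (c₀ ℕ.* n₀) ⟨
    natC (c₃ ℕ.* n₃ ℕ.+ c₂ ℕ.* n₂ ℕ.+ c₁ ℕ.* n₁ ℕ.+ c₀ ℕ.* n₀) ∎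
    where
    term : ∀ s {x n} → x ≈ natC n → natC s * x ≈ natC (s ℕ.* n)
    term s {n = n} e = trans (*-congˡ e) (sym (natC-homo-* s n))

  inverse-unique : ∀ {x u v} → x * u ≈ 1# → x * v ≈ 1# → u ≈ v
  inverse-unique {x} {u} {v} xu≈1 xv≈1 = begin
    u           ≈⟨ *-identityˡ u ⟨
    1# * u      ≈⟨ *-congʳ xv≈1 ⟨
    x * v * u   ≈⟨ solve 3 (λ x u v → x :* v :* u := x :* u :* v) refl x u v ⟩
    x * u * v   ≈⟨ *-congʳ xu≈1 ⟩
    1# * v      ≈⟨ *-identityˡ v ⟩
    v           ∎

  pow-narayana : ∀ {y} → y * y * y ≈ y * y + 1# → IsNarayana (pow y)
  pow-narayana {y} cubic k = begin
    y * (y * (y * yᵏ))   ≈⟨ solve 2 (λ y z → y :* (y :* (y :* z)) := y :* y :* y :* z) refl y yᵏ ⟩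
    y * y * y * yᵏ       ≈⟨ *-congʳ cubic ⟩
    (y * y + 1#) * yᵏ    ≈⟨ distribʳ yᵏ (y * y) 1# ⟩
    y * y * yᵏ + 1# * yᵏ ≈⟨ +-cong (*-assoc y y yᵏ) (*-identityˡ yᵏ) ⟩
    y * (y * yᵏ) + yᵏ    ∎
    where
    yᵏ : Carrier
    yᵏ = pow y k

  shiftedPow : Carrier → Carrier → ℕ → Carrier
  shiftedPow y w k = zpow y w (+ k -ℤ + 2)

  -- The recurrence y^(k+1) = y^k + y^(k-2) also holds for k < 2: multiplying
  -- y³ = y² + 1 by w² and by w gives y = 1 + w² and y² = y + w.
  shiftedPow-narayana : ∀ {y w} → y * w ≈ 1# → y * y * y ≈ y * y + 1# →
                        IsNarayana (shiftedPow y w)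
  shiftedPow-narayana {y} {w} yw≈1 cubic = recurrence
    where
    recurrence : IsNarayana (shiftedPow y w)
    recurrence 0 = begin
      y * 1#                           ≈⟨ *-congˡ (trans (*-cong yw≈1 yw≈1) (*-identityˡ 1#)) ⟨
      y * ((y * w) * (y * w))          ≈⟨ solve 2 (λ y w → y :* ((y :* w) :* (y :* w)) := y :* y :* y :* (w :* w)) refl y w ⟩
      y * y * y * (w * w)              ≈⟨ *-congʳ cubic ⟩
      (y * y + 1#) * (w * w)           ≈⟨ solve 3 (λ y w o → (y :* y :+ o) :* (w :* w) := (y :* w) :* (y :* w) :+ w :* (w :* o)) refl y w 1# ⟩
      (y * w) * (y * w) + w * (w * 1#) ≈⟨ +-congʳ (trans (*-cong yw≈1 yw≈1) (*-identityˡ 1#)) ⟩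
      1# + w * (w * 1#)                ∎
    recurrence 1 = begin
      y * (y * 1#)              ≈⟨ *-congˡ (*-congˡ yw≈1) ⟨
      y * (y * (y * w))         ≈⟨ solve 2 (λ y w → y :* (y :* (y :* w)) := y :* y :* y :* w) refl y w ⟩
      y * y * y * w             ≈⟨ *-congʳ cubic ⟩
      (y * y + 1#) * w          ≈⟨ solve 3 (λ y w o → (y :* y :+ o) :* w := y :* (y :* w) :+ w :* o) refl y w 1# ⟩
      y * (y * w) + w * 1#      ≈⟨ +-congʳ (*-congˡ yw≈1) ⟩
      y * 1# + w * 1#           ∎
    recurrence (suc (suc k)) = pow-narayana cubic k

  e₁ e₂ e₃ : Carrier → Carrier → Carrier → Carrier
  e₁ a b c = a + b + c
  e₂ a b c = a * b + b * c + c * a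
  e₃ a b c = a * b * c

  record CubicRoots (a b c : Carrier) : Set ℓ where
    field
      e₁≈0 : e₁ a b c ≈ 0#
      e₂≈1 : e₂ a b c ≈ 1#
      e₃≈1 : e₃ a b c ≈ 1#

  fromRootTriple : ∀ {a b c} → IsRootTriple a b c → CubicRoots a b c
  fromRootTriple (-e₁≈0 , e₂≈1 , -e₃≈-1) = record
    { e₁≈0 = -‿injective (trans -e₁≈0 (sym -0#≈0#))
    ; e₂≈1 = e₂≈1
    ; e₃≈1 = -‿injective -e₃≈-1
    }

  rotate : ∀ {a b c} → CubicRoots a b c → CubicRoots b c a
  rotate {a} {b} {c} r = record
    { e₁≈0 = trans (solve 3 (λ a b c → b :+ c :+ a := a :+ b :+ c) refl a b c) e₁≈0
    ; e₂≈1 = trans (solve 3 (λ a b c → b :* c :+ c :* a :+ a :* b := a :* b :+ b :* c :+ c :* a) refl a b c) e₂≈1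
    ; e₃≈1 = trans (solve 3 (λ a b c → b :* c :* a := a :* b :* c) refl a b c) e₃≈1
    }
    where open CubicRoots r

  -- ab is a root of X³ - e₂X² + e₁e₃X - e₃², whose roots are ab, bc, ca.
  product-identity : ∀ a b c → let y = a * b in
    y * y * y + e₃ a b c * e₁ a b c * y ≈ e₂ a b c * (y * y) + e₃ a b c * e₃ a b c
  product-identity = solve 3 (λ a b c →
    (a :* b) :* (a :* b) :* (a :* b) :+ (a :* b :* c) :* (a :+ b :+ c) :* (a :* b)
      := (a :* b :+ b :* c :+ c :* a) :* ((a :* b) :* (a :* b)) :+ (a :* b :* c) :* (a :* b :* c)) refl

  product-cubic : ∀ {a b c} → CubicRoots a b c →
                  (a * b) * (a * b) * (a * b) ≈ (a * b) * (a * b) + 1#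
  product-cubic {a} {b} {c} r = begin
    y * y * y                                        ≈⟨ +-identityʳ _ ⟨
    y * y * y + 0#                                   ≈⟨ +-congˡ e₃e₁y≈0 ⟨
    y * y * y + e₃ a b c * e₁ a b c * y              ≈⟨ product-identity a b c ⟩
    e₂ a b c * (y * y) + e₃ a b c * e₃ a b c         ≈⟨ +-cong (*-congʳ e₂≈1) (*-cong e₃≈1 e₃≈1) ⟩
    1# * (y * y) + 1# * 1#                           ≈⟨ +-cong (*-identityˡ _) (*-identityˡ 1#) ⟩
    y * y + 1#                                       ∎
    where
    open CubicRoots r
    y : Carrier
    y = a * b
    e₃e₁y≈0 : e₃ a b c * e₁ a b c * y ≈ 0#
    e₃e₁y≈0 = trans (*-congʳ (trans (*-congˡ e₁≈0) (zeroʳ _))) (zeroˡ y)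

  -- Since abc = 1, the inverse of ab is the remaining root c.
  product-inverse : ∀ {a b c w} → CubicRoots a b c → (a * b) * w ≈ 1# → w ≈ c
  product-inverse r ab·w≈1 = inverse-unique ab·w≈1 (CubicRoots.e₃≈1 r)

  module PowerSums (x₁ x₂ x₃ : Carrier) (roots : CubicRoots x₁ x₂ x₃)
                   (w₁₂ w₂₃ w₃₁ : Carrier)
                   (inv₁₂ : (x₁ * x₂) * w₁₂ ≈ 1#) (inv₂₃ : (x₂ * x₃) * w₂₃ ≈ 1#)
                   (inv₃₁ : (x₃ * x₁) * w₃₁ ≈ 1#) where
    open CubicRoots roots

    roots₂ : CubicRoots x₂ x₃ x₁
    roots₂ = rotate roots

    roots₃ : CubicRoots x₃ x₁ x₂
    roots₃ = rotate roots₂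

    S : ℕ → Carrier
    S k = p x₁ x₂ x₃ w₁₂ w₂₃ w₃₁ (+ k -ℤ + 2)

    S-narayana : IsNarayana S
    S-narayana =
      narayana-sum (narayana-sum
        (shiftedPow-narayana inv₁₂ (product-cubic roots))
        (shiftedPow-narayana inv₂₃ (product-cubic roots₂)))
        (shiftedPow-narayana inv₃₁ (product-cubic roots₃))

    -- p₋₁ = x₃ + x₁ + x₂ = e₁, since the inverse of xᵢxⱼ is the third root.
    S₁ : S 1 ≈ natC 0
    S₁ = begin
      w₁₂ * 1# + w₂₃ * 1# + w₃₁ * 1#
        ≈⟨ +-cong (+-cong (inverse-term inv₁₂ roots) (inverse-term inv₂₃ roots₂)) (inverse-term inv₃₁ roots₃) ⟩
      x₃ + x₁ + x₂ ≈⟨ solve 3 (λ a b c → c :+ a :+ b := a :+ b :+ c) refl x₁ x₂ x₃ ⟩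
      e₁ x₁ x₂ x₃  ≈⟨ e₁≈0 ⟩
      0#           ∎
      where
      inverse-term : ∀ {a b c w} → (a * b) * w ≈ 1# → CubicRoots a b c → w * 1# ≈ c
      inverse-term ab·w≈1 r = trans (*-identityʳ _) (product-inverse r ab·w≈1)

    S₂ : S 2 ≈ natC 3
    S₂ = trans (+-assoc 1# 1# 1#) (+-congˡ (+-congˡ (sym (+-identityʳ 1#))))

    S₃ : S 3 ≈ natC 1
    S₃ = begin
      x₁ * x₂ * 1# + x₂ * x₃ * 1# + x₃ * x₁ * 1#
        ≈⟨ +-cong (+-cong (*-identityʳ _) (*-identityʳ _)) (*-identityʳ _) ⟩
      e₂ x₁ x₂ x₃ ≈⟨ e₂≈1 ⟩
      1#          ≈⟨ +-identityʳ 1# ⟨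
      natC 1      ∎

    S₄ : S 4 ≈ natC 1
    S₄ = narayana-natC S-narayana 1 0 1 S₁ S₃

    S₅ : S 5 ≈ natC 4
    S₅ = narayana-natC S-narayana 2 3 1 S₂ S₄

    S₆ : S 6 ≈ natC 5
    S₆ = narayana-natC S-narayana 3 1 4 S₃ S₅

    -- 31 aₙ = 6 S(n+3) + 4 S(n+2) + 7 S(n+1) + 9 S(n): both sides are Narayana
    -- sequences in n, and they agree at n = 1, 2, 3 (values 31, 62, 62).
    identity : ∀ n → natC 31 * natC (a n) ≈ weighted (natC 6) (natC 4) (natC 7) (natC 9) S n
    identity = narayana-unique
      (narayana-scale (natC 31) narayana-a)
      (narayana-weighted (natC 6) (natC 4) (natC 7) (natC 9) S-narayana)
      (trans (sym (natC-homo-* 31 (a 1))) (sym (weighted-natC {S} 6 4 7 9 1 1 1 3 0 S₄ S₃ S₂ S₁)))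
      (trans (sym (natC-homo-* 31 (a 2))) (sym (weighted-natC {S} 6 4 7 9 2 4 1 1 3 S₅ S₄ S₃ S₂)))
      (trans (sym (natC-homo-* 31 (a 3))) (sym (weighted-natC {S} 6 4 7 9 3 5 4 1 1 S₆ S₅ S₄ S₃)))

-- Rewriting S (n+3) and S (n+1) as p_{n+1} and p_{n-1} is integer
-- arithmetic on the indices; S (n+2) and S n are pₙ and p_{n-2} on the nose.
mainTheorem8 : ∀ {c ℓ : Level} (R : CommutativeRing c ℓ) →
  let open CommutativeRing R
      open RingDefs R
  in (x₁ x₂ x₃ : Carrier) → IsRootTriple x₁ x₂ x₃ →
     (w₁₂ w₂₃ w₃₁ : Carrier) →
     (x₁ * x₂) * w₁₂ ≈ 1# → (x₂ * x₃) * w₂₃ ≈ 1# → (x₃ * x₁) * w₃₁ ≈ 1# →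
     (n : ℕ) →
     natC 31 * natC (a n) ≈
       natC 6 * p x₁ x₂ x₃ w₁₂ w₂₃ w₃₁ (+ n +ℤ + 1)
       + natC 4 * p x₁ x₂ x₃ w₁₂ w₂₃ w₃₁ (+ n)
       + natC 7 * p x₁ x₂ x₃ w₁₂ w₂₃ w₃₁ (+ n -ℤ + 1)
       + natC 9 * p x₁ x₂ x₃ w₁₂ w₂₃ w₃₁ (+ n -ℤ + 2)
mainTheorem8 R x₁ x₂ x₃ rootTriple w₁₂ w₂₃ w₃₁ inv₁₂ inv₂₃ inv₃₁ n =
  trans (identity n) (reflexive (cong₂ combination index-n+1 index-n-1))
  where
  open CommutativeRing R
  open RingDefs R
  open NarayanaIdentity R
  open PowerSums x₁ x₂ x₃ (fromRootTriple rootTriple) w₁₂ w₂₃ w₃₁ inv₁₂ inv₂₃ inv₃₁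

  combination : ℤ → ℤ → Carrier
  combination i j =
    natC 6 * p x₁ x₂ x₃ w₁₂ w₂₃ w₃₁ i + natC 4 * p x₁ x₂ x₃ w₁₂ w₂₃ w₃₁ (+ n)
    + natC 7 * p x₁ x₂ x₃ w₁₂ w₂₃ w₃₁ j + natC 9 * p x₁ x₂ x₃ w₁₂ w₂₃ w₃₁ (+ n -ℤ + 2)

  index-n+1 : + (3 ℕ.+ n) -ℤ + 2 ≡ + n +ℤ + 1
  index-n+1 = cong +_ (ℕₚ.+-comm 1 n)

  index-n-1 : + (1 ℕ.+ n) -ℤ + 2 ≡ + n -ℤ + 1
  index-n-1 = [1+m]⊖[1+n]≡m⊖n n 1
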